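{- Let $a,k\in\mathbb{N}\setminus\{1\}$, let $F=\{1,a,a^2,\dots,a^{k-1}\}$, and let $S(a,k)=\{n\in\mathbb{N}:\nu_a(n)\equiv k-1 \pmod k\}$. Let $N\in\mathbb{N}$. If $X\subseteq\mathbb{N}$ is multiplicatively $F$-syndetic, then $|X\cap[N]|\geq|S(a,k)\cap[N]|$.
   Context: $\mathbb{N}=\{1,2,3,\dots\}$, $[N]=\{1,\dots,N\}$. For an integer $a\ge 2$, $\nu_a(n)=\max\{j\in\mathbb{N}\cup\{0\}:a^j\mid n\}$. For a non-empty finite $F\subset\mathbb{N}$, $X\subseteq\mathbb{N}$ is multiplicatively $F$-syndetic if for every $n\in\mathbb{N}$ there is $t\in F$ with $nt\in X$. -}

module Defs where

open import Data.Nat using (ℕ; zero; suc; _+_; _*_; _∸_; _^_; _≤_; _<_; NonZero)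
open import Data.Nat.DivMod using (_/_; _%_)
open import Data.Nat.Divisibility using (_∣_; _∣?_)
open import Data.Nat.Properties using (_≟_)
open import Data.Bool using (Bool; true; false; if_then_else_)
open import Data.Product using (Σ; _×_; _,_)
open import Relation.Nullary using (yes; no)
open import Relation.Nullary.Decidable using (⌊_⌋)

νfuel : ℕ → ℕ → ℕ → ℕ
νfuel zero    a n = 0
νfuel (suc f) zero n = 0
νfuel (suc f) (suc a) zero = 0
νfuel (suc f) (suc a) (suc n) with suc a ∣? suc n
... | yes _ = suc (νfuel f (suc a) (suc n / suc a))
... | no  _ = 0

-- ν_a(n) = max { j : a^j ∣ n } for a ≥ 2 and n ≥ 1 (fuel n suffices since a^j ≤ n).
ν : ℕ → ℕ → ℕ
ν a n = νfuel n a n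

count : (ℕ → Bool) → ℕ → ℕ
count P zero    = 0
count P (suc N) = (if P (suc N) then 1 else 0) + count P N

S : (a k : ℕ) → .{{NonZero k}} → ℕ → Bool
S a k n = ⌊ ν a n % k ≟ k ∸ 1 ⌋

open import Data.List using (List; map; upTo)
open import Data.List.Membership.Propositional using (_∈_)
open import Relation.Binary.PropositionalEquality using (_≡_)

MultSyndetic : List ℕ → (ℕ → Bool) → Set
MultSyndetic F X = (n : ℕ) → 1 ≤ n → Σ ℕ λ t → t ∈ F × X (n * t) ≡ true

powers : ℕ → ℕ → List ℕ
powers a k = map (a ^_) (upTo k)

-- Every n ∈ S(a,k) factors as n = a^(k-1) m with ν_a(m) ≡ 0 (mod k), and syndeticity gives
-- some i < k with a^i m ∈ X. The map n ↦ a^i m does not increase n and is injective, since i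
-- is recovered as ν_a(a^i m) mod k and then m by cancellation; such a map from S into X
-- forces |S ∩ [N]| ≤ |X ∩ [N]| for every N.
module Submission where

open import Data.Bool using (Bool; true; false; if_then_else_; T)
open import Data.List.Membership.Propositional using (_∈_)
open import Data.List.Membership.Propositional.Properties using (∈-map⁻; ∈-upTo⁻)
open import Data.Nat
open import Data.Nat.DivMod
open import Data.Nat.Divisibility
open import Data.Nat.Properties
open import Data.Product using (∃-syntax; _×_; _,_; proj₂)
open import Data.Sum using (inj₁; inj₂)
open import Data.Unit using (tt)
open import Function using (_∘_)
open import Relation.Binary.PropositionalEquality
open import Relation.Nullary using (yes; no; contradiction)
open import Relation.Nullary.Decidable using (⌊_⌋; toWitness)

open import Defs

Member : (ℕ → Bool) → ℕ → Set
Member P n = 1 ≤ n × P n ≡ true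

_without_ : (ℕ → Bool) → ℕ → ℕ → Bool
(P without y) n = if ⌊ n ≟ y ⌋ then false else P n

without-self : ∀ P y → (P without y) y ≡ false
without-self P y with y ≟ y
... | yes _   = refl
... | no y≢y  = contradiction refl y≢y

without-≢ : ∀ P {y n} → n ≢ y → (P without y) n ≡ P n
without-≢ P {y} {n} n≢y with n ≟ y
... | yes n≡y = contradiction n≡y n≢y
... | no _    = refl

member-without : ∀ {P y n} → Member P n → n ≢ y → Member (P without y) n
member-without {P} (n≥1 , Pn) n≢y = n≥1 , trans (without-≢ P n≢y) Pn

without-member : ∀ {P y n} → Member (P without y) n → n ≢ y × Member P n
without-member {P} {y} {n} (n≥1 , Pn) with n ≟ y
... | yes _   = contradiction Pn λ ()
... | no n≢y  = n≢y , n≥1 , Pn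

count-cong : ∀ {P Q} N → (∀ {n} → 1 ≤ n → n ≤ N → P n ≡ Q n) → count P N ≡ count Q N
count-cong zero    _    = refl
count-cong (suc N) P≗Q = cong₂ (λ b c → (if b then 1 else 0) + c)
  (P≗Q (s≤s z≤n) ≤-refl) (count-cong N (λ n≥1 n≤N → P≗Q n≥1 (m≤n⇒m≤1+n n≤N)))

count-≤-suc : ∀ P N → count P N ≤ count P (suc N)
count-≤-suc P N = m≤n+m (count P N) _

count-without-> : ∀ P {y} N → N < y → count (P without y) N ≡ count P N
count-without-> P N N<y = count-cong N λ _ n≤N → without-≢ P (<⇒≢ (≤-<-trans n≤N N<y))

count-without : ∀ P {y} N → Member P y → y ≤ N → count P N ≡ suc (count (P without y) N)
count-without P zero    (() , _) z≤n
count-without P {y} (suc N) (y≥1 , Py) y≤1+N with m≤n⇒m<n∨m≡n y≤1+N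
... | inj₂ refl rewrite without-self P (suc N) | Py = cong suc (sym (count-without-> P N ≤-refl))
... | inj₁ (s≤s y≤N) rewrite without-≢ P (>⇒≢ (s≤s y≤N)) =
  trans (cong ((if P (suc N) then 1 else 0) +_) (count-without P N (y≥1 , Py) y≤N)) (+-suc _ _)

record DecreasingInjection (P Q : ℕ → Bool) : Set where
  field
    to           : ∀ {n} → Member P n → ℕ
    to-≤         : ∀ {n} (p : Member P n) → to p ≤ n
    to-member    : ∀ {n} (p : Member P n) → Member Q (to p)
    to-injective : ∀ {m n} (p : Member P m) (q : Member P n) → to p ≡ to q → m ≡ n

module _ {P Q : ℕ → Bool} (f : DecreasingInjection P Q) where
  open DecreasingInjection f

  restrict : ∀ {x} (px : Member P x) → DecreasingInjection (P without x) (Q without to px)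
  restrict px = record
    { to           = to ∘ unrestrict
    ; to-≤         = to-≤ ∘ unrestrict
    ; to-member    = λ p → let n≢x , pn = without-member {P} p in
        member-without {Q} (to-member pn) (n≢x ∘ to-injective pn px)
    ; to-injective = λ p q → to-injective (unrestrict p) (unrestrict q)
    }
    where
    unrestrict : ∀ {n} → Member (P without _) n → Member P n
    unrestrict = proj₂ ∘ without-member {P}

decreasingInjection⇒count-≤ : ∀ {P Q} → DecreasingInjection P Q → ∀ N → count P N ≤ count Q N
decreasingInjection⇒count-≤ f zero = z≤n
decreasingInjection⇒count-≤ {P} {Q} f (suc N) with P (suc N) in P[1+N]
... | false = ≤-trans (decreasingInjection⇒count-≤ f N) (count-≤-suc Q N)
... | true  = begin
  suc (count P N)                     ≡⟨ cong suc (count-without-> P N ≤-refl) ⟨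
  suc (count (P without suc N) N)     ≤⟨ s≤s (decreasingInjection⇒count-≤ (restrict f px) N) ⟩
  suc (count (Q without y) N)         ≤⟨ s≤s (count-≤-suc _ N) ⟩
  suc (count (Q without y) (suc N))   ≡⟨ count-without Q (suc N) (to-member px) (to-≤ px) ⟨
  count Q (suc N)                     ∎
  where
  open DecreasingInjection f
  open ≤-Reasoning
  px = s≤s z≤n , P[1+N]
  y  = to px

^νfuel∣ : ∀ f a n → a ^ νfuel f a n ∣ n
^νfuel∣ zero    a       n       = 1∣ n
^νfuel∣ (suc f) zero    n       = 1∣ n
^νfuel∣ (suc f) (suc a) zero    = 1∣ 0
^νfuel∣ (suc f) (suc a) (suc n) with suc a ∣? suc n
... | yes a∣n = m∣n/o⇒o*m∣n a∣n (^νfuel∣ f (suc a) (suc n / suc a))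
... | no  _   = 1∣ suc n

^ν∣ : ∀ a n → a ^ ν a n ∣ n
^ν∣ a n = ^νfuel∣ n a n

^-monoʳ-∣ : ∀ a {i j} → i ≤ j → a ^ i ∣ a ^ j
^-monoʳ-∣ a {i} {j} i≤j = subst (a ^ i ∣_) a^i*a^[j∸i]≡a^j (m∣m*n (a ^ (j ∸ i)))
  where
  a^i*a^[j∸i]≡a^j : a ^ i * a ^ (j ∸ i) ≡ a ^ j
  a^i*a^[j∸i]≡a^j = trans (sym (^-distribˡ-+-* a i (j ∸ i))) (cong (a ^_) (m+[n∸m]≡n i≤j))

*-positiveʳ : ∀ {d q n} → 1 ≤ n → n ≡ d * q → 1 ≤ q
*-positiveʳ {d} {zero}  n≥1 n≡d*0 = contradiction (trans n≡d*0 (*-zeroʳ d)) (>⇒≢ n≥1)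
*-positiveʳ {q = suc _} _   _     = s≤s z≤n

ν-factor : ∀ a {j n} → 1 ≤ n → j ≤ ν a n → ∃[ m ] 1 ≤ m × n ≡ a ^ j * m
ν-factor a {j} {n} n≥1 j≤νn = quotient a^j∣n , *-positiveʳ {a ^ j} n≥1 n≡a^j*m , n≡a^j*m
  where
  a^j∣n : a ^ j ∣ n
  a^j∣n = ∣-trans (^-monoʳ-∣ a j≤νn) (^ν∣ a n)
  n≡a^j*m : n ≡ a ^ j * quotient a^j∣n
  n≡a^j*m = m∣n⇒n≡m*quotient a^j∣n

^-positive : ∀ {a} → 2 ≤ a → ∀ i → 1 ≤ a ^ i
^-positive {2+ b} (s≤s (s≤s z≤n)) i = m^n>0 (2+ b) i

-- Any fuel ≥ n gives ν, since each step divides the argument by a ≥ 2.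
νfuel-fuel : ∀ b {f g} n → n ≤ f → n ≤ g → νfuel f (2+ b) n ≡ νfuel g (2+ b) n
νfuel-fuel b {zero}  {zero}  n       _       _       = refl
νfuel-fuel b {zero}  {suc g} zero    _       _       = refl
νfuel-fuel b {suc f} {zero}  zero    _       _       = refl
νfuel-fuel b {suc f} {suc g} zero    _       _       = refl
νfuel-fuel b {suc f} {suc g} (suc n) (s≤s n≤f) (s≤s n≤g) with 2+ b ∣? suc n
... | yes _ = cong suc (νfuel-fuel b (suc n / 2+ b) (≤-trans q≤n n≤f) (≤-trans q≤n n≤g))
  where q≤n = <⇒≤pred (m/n<m (suc n) (2+ b) (s≤s (s≤s z≤n)))
... | no  _ = refl

ν-*-self : ∀ {a m} → 2 ≤ a → 1 ≤ m → ν a (a * m) ≡ suc (ν a m)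
ν-*-self {2+ b} {suc m} (s≤s (s≤s z≤n)) _ with 2+ b ∣? 2+ b * suc m
... | yes _ = cong suc (begin
  νfuel (m + suc b * suc m) (2+ b) (2+ b * suc m / 2+ b) ≡⟨ cong (νfuel (m + suc b * suc m) (2+ b)) a*m/a≡m ⟩
  νfuel (m + suc b * suc m) (2+ b) (suc m)               ≡⟨ νfuel-fuel b (suc m) (m<m+n m {suc b * suc m} (s≤s z≤n)) ≤-refl ⟩
  ν (2+ b) (suc m)                                       ∎)
  where
  open ≡-Reasoning
  a*m/a≡m = trans (cong (_/ 2+ b) (*-comm (2+ b) (suc m))) (m*n/n≡m (suc m) (2+ b))
... | no ∤ = contradiction (m∣m*n (suc m)) ∤

ν-^-* : ∀ {a} → 2 ≤ a → ∀ i {m} → 1 ≤ m → ν a (a ^ i * m) ≡ i + ν a m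
ν-^-* {a} a≥2 zero    {m} m≥1 = cong (ν a) (+-identityʳ m)
ν-^-* {a} a≥2 (suc i) {m} m≥1 = begin
  ν a (a * a ^ i * m)   ≡⟨ cong (ν a) (*-assoc a (a ^ i) m) ⟩
  ν a (a * (a ^ i * m)) ≡⟨ ν-*-self a≥2 (*-mono-≤ (^-positive a≥2 i) m≥1) ⟩
  suc (ν a (a ^ i * m)) ≡⟨ cong suc (ν-^-* a≥2 i m≥1) ⟩
  suc (i + ν a m)       ∎
  where open ≡-Reasoning

ν-cofactor-∣ : ∀ {a k n m} .{{_ : NonZero k}} → 2 ≤ a → 1 ≤ m →
  n ≡ a ^ (ν a n % k) * m → k ∣ ν a m
ν-cofactor-∣ {a} {k} {n} {m} a≥2 m≥1 n≡ = divides (ν a n / k) (+-cancelˡ-≡ (ν a n % k) _ _ (begin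
  ν a n % k + ν a m              ≡⟨ ν-^-* a≥2 (ν a n % k) m≥1 ⟨
  ν a (a ^ (ν a n % k) * m)      ≡⟨ cong (ν a) n≡ ⟨
  ν a n                          ≡⟨ m≡m%n+[m/n]*n (ν a n) k ⟩
  ν a n % k + ν a n / k * k      ∎))
  where open ≡-Reasoning

ν%-factor : ∀ {a k n} .{{_ : NonZero k}} → 2 ≤ a → 1 ≤ n →
  ∃[ m ] 1 ≤ m × n ≡ a ^ (ν a n % k) * m × k ∣ ν a m
ν%-factor {a} {k} {n} a≥2 n≥1 with m , m≥1 , n≡ ← ν-factor a n≥1 (m%n≤m (ν a n) k) =
  m , m≥1 , n≡ , ν-cofactor-∣ a≥2 m≥1 n≡

ν-^-*-% : ∀ {a k m} i .{{_ : NonZero k}} → 2 ≤ a → 1 ≤ m → k ∣ ν a m → i < k →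
  ν a (a ^ i * m) % k ≡ i
ν-^-*-% {a} {k} {m} i a≥2 m≥1 (divides q νm≡q*k) i<k = begin
  ν a (a ^ i * m) % k  ≡⟨ cong (_% k) (ν-^-* a≥2 i m≥1) ⟩
  (i + ν a m) % k      ≡⟨ cong (λ x → (i + x) % k) νm≡q*k ⟩
  (i + q * k) % k      ≡⟨ [m+kn]%n≡m%n i q k ⟩
  i % k                ≡⟨ m<n⇒m%n≡m i<k ⟩
  i                    ∎
  where open ≡-Reasoning

∈-powers⁻ : ∀ {a k t} → t ∈ powers a k → ∃[ i ] i < k × t ≡ a ^ i
∈-powers⁻ t∈F with i , i∈ , t≡a^i ← ∈-map⁻ _ t∈F = i , ∈-upTo⁻ i∈ , t≡a^i

S⇒ν% : ∀ {a k n} .{{_ : NonZero k}} → S a k n ≡ true → ν a n % k ≡ k ∸ 1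
S⇒ν% n∈S = toWitness (subst T (sym n∈S) tt)

module _ {a k : ℕ} .{{_ : NonZero k}} (a≥2 : 2 ≤ a)
         {X : ℕ → Bool} (X-syndetic : MultSyndetic (powers a k) X) where

  private instance
    a≢0 : NonZero a
    a≢0 = >-nonZero (<-≤-trans z<s a≥2)

  record Decomposition (n : ℕ) : Set where
    field
      m i           : ℕ
      m≥1           : 1 ≤ m
      n≡a^[k∸1]*m   : n ≡ a ^ (k ∸ 1) * m
      k∣νm          : k ∣ ν a m
      i<k           : i < k
      a^i*m∈X       : X (a ^ i * m) ≡ true

    image : ℕ
    image = a ^ i * m

  open Decomposition

  decompose : ∀ {n} → Member (S a k) n → Decomposition n
  decompose {n} (n≥1 , n∈S)
    with m , m≥1 , n≡ , k∣νm ← ν%-factor a≥2 n≥1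
    with t , t∈F , mt∈X ← X-syndetic m m≥1
    with i , i<k , refl ← ∈-powers⁻ t∈F = record
      { m = m ; i = i ; m≥1 = m≥1 ; n≡a^[k∸1]*m = subst (λ r → n ≡ a ^ r * m) (S⇒ν% {a} {k} {n} n∈S) n≡
      ; k∣νm = k∣νm ; i<k = i<k ; a^i*m∈X = subst (λ x → X x ≡ true) (*-comm m (a ^ i)) mt∈X }

  image-≤ : ∀ {n} (D : Decomposition n) → image D ≤ n
  image-≤ {n} D = begin
    a ^ i D * m D        ≤⟨ *-monoˡ-≤ (m D) (^-monoʳ-≤ a (<⇒≤pred (i<k D))) ⟩
    a ^ (k ∸ 1) * m D    ≡⟨ n≡a^[k∸1]*m D ⟨
    n                    ∎
    where
    open ≤-Reasoning

  image-member : ∀ {n} (D : Decomposition n) → Member X (image D)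
  image-member D = *-mono-≤ (^-positive a≥2 (i D)) (m≥1 D) , a^i*m∈X D

  image-injective : ∀ {n n'} (D : Decomposition n) (D' : Decomposition n') → image D ≡ image D' → n ≡ n'
  image-injective D D' eq = begin
    _                      ≡⟨ n≡a^[k∸1]*m D ⟩
    a ^ (k ∸ 1) * m D      ≡⟨ cong (a ^ (k ∸ 1) *_) m≡m' ⟩
    a ^ (k ∸ 1) * m D'     ≡⟨ n≡a^[k∸1]*m D' ⟨
    _                      ∎
    where
    open ≡-Reasoning
    i≡i' : i D ≡ i D'
    i≡i' = begin
      i D                       ≡⟨ ν-^-*-% (i D) a≥2 (m≥1 D) (k∣νm D) (i<k D) ⟨
      ν a (image D) % k         ≡⟨ cong (λ x → ν a x % k) eq ⟩
      ν a (image D') % k        ≡⟨ ν-^-*-% (i D') a≥2 (m≥1 D') (k∣νm D') (i<k D') ⟩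
      i D'                      ∎
    m≡m' : m D ≡ m D'
    m≡m' = *-cancelˡ-≡ (m D) (m D') (a ^ i D) {{m^n≢0 a (i D)}} (trans eq (cong (λ j → a ^ j * m D') (sym i≡i')))

  S↣X : DecreasingInjection (S a k) X
  S↣X = record
    { to           = image ∘ decompose
    ; to-≤         = image-≤ ∘ decompose
    ; to-member    = image-member ∘ decompose
    ; to-injective = λ p q → image-injective (decompose p) (decompose q)
    }

theorem3p4 : (a k : ℕ) → a ≥ 2 → k ≥ 2 → .{{_ : NonZero k}} → (N : ℕ) →
    (X : ℕ → Bool) → MultSyndetic (powers a k) X →
    count (S a k) N ≤ count X N
theorem3p4 a k a≥2 _ N X X-syndetic = decreasingInjection⇒count-≤ (S↣X a≥2 X-syndetic) N
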